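{- Let $N\ge 1$ and consider the graph $\mathcal{C}_3^N$. Let $0\le r\le N$ and let $f$ be a vertex function supported on $\Sigma_r=\{v: d(v)=r\}$. Then $Cf=(2N-3r)f-A_0f$, where $C=A_-A_+-A_+A_-$. In particular, $C+A_0$ acts as the scalar $2N-3r$ on functions supported on $\Sigma_r$.
   Context: Vertices of $\mathcal{C}_3^N$ are elements $v=(\ell_1,\dots,\ell_N)$ of $\mathbb{Z}_3^N$ with $\ell_i\in\{ -1,0,1\}$; $v\sim w$ iff $v-w=\pm e_k$ (mod 3) for some $k$, where $e_k$ is the $k$th standard generator. Levels: $d_k(v)=|\ell_k|$, $d(v)=\sum_k d_k(v)$. For a vertex $v$, $\tilde v_k$ denotes the vertex obtained from $v$ by replacing $\ell_k$ by $-\ell_k$. Vertex functions are maps $\mathbb{Z}_3^N\to\mathbb{C}$. Outer adjacency: $(A_+f)(v)=\sum_{w\sim v,\ d(w)=d(v)-1}f(w)$; inner adjacency (its adjoint): $(A_-f)(v)=\sum_{w\sim v,\ d(w)=d(v)+1}f(w)$; neutral adjacency: $(A_0f)(v)=\sum_{w\sim v,\ d(w)=d(v)}f(w)=\sum_{k:\,d_k(v)=1}f(\tilde v_k)$. -}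

module Defs where

open import Level using (Level)
open import Data.Nat using (ℕ; zero; suc; _≟_)
import Data.Nat as ℕ
open import Data.Fin using (Fin)
open import Data.Vec using (Vec; updateAt; foldr)
open import Data.List using (List; []; _∷_; filter; map; concatMap; allFin)
import Data.List as L
open import Algebra.Bundles using (CommutativeRing)
open import Relation.Binary.PropositionalEquality using (_≡_)

-- Elements of ℤ₃, written with representatives -1, 0, 1.
data Z3 : Set where
  neg zer pos : Z3

inc3 : Z3 → Z3
inc3 neg = zer
inc3 zer = pos
inc3 pos = neg

dec3 : Z3 → Z3
dec3 neg = pos
dec3 zer = neg
dec3 pos = zer

absZ3 : Z3 → ℕ
absZ3 zer = 0
absZ3 neg = 1
absZ3 pos = 1

Vertex : ℕ → Set
Vertex N = Vec Z3 N

d : {N : ℕ} → Vertex N → ℕ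
d = foldr _ (λ x acc → absZ3 x ℕ.+ acc) 0

neighbours : {N : ℕ} → Vertex N → List (Vertex N)
neighbours {N} v = concatMap (λ k → updateAt v k inc3 ∷ updateAt v k dec3 ∷ []) (allFin N)

module Ops {c ℓ : Level} (R : CommutativeRing c ℓ) where
  open CommutativeRing R

  Σ : List Carrier → Carrier
  Σ = L.foldr _+_ 0#

  ι : ℕ → Carrier
  ι zero = 0#
  ι (suc n) = 1# + ι n

  VFun : ℕ → Set c
  VFun N = Vertex N → Carrier

  A₊ : {N : ℕ} → VFun N → VFun N
  A₊ f v = Σ (map f (filter (λ w → suc (d w) ≟ d v) (neighbours v)))

  A₋ : {N : ℕ} → VFun N → VFun N
  A₋ f v = Σ (map f (filter (λ w → d w ≟ suc (d v)) (neighbours v)))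

  A₀ : {N : ℕ} → VFun N → VFun N
  A₀ f v = Σ (map f (filter (λ w → d w ≟ d v) (neighbours v)))

  C : {N : ℕ} → VFun N → VFun N
  C f v = A₋ (A₊ f) v - A₊ (A₋ f) v

-- Write v = x ∷ u. Each adjacency operator splits into a part moving the coordinate x
-- in the 3-cycle C₃ and a part moving u in C₃^(N-1). In A₋A₊ and A₊A₋ the mixed terms
-- (one step in x, one in u) coincide, so by induction on N everything reduces to the
-- identity A₋A₊φ + A₀φ + 3|x|φ = A₊A₋φ + 2φ on C₃, checked at its three vertices.
-- Summing gives A₋A₊f + A₀f + 3d(v)f = A₊A₋f + 2Nf at every v for every f (both sides
-- see f only on the level of v); it is subtraction-free, so it is proved over commutative
-- semirings. For f supported on Σ_r the scalar 2N − 3d(v) may be replaced by 2N − 3r.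

module Submission where

open import Defs
open import Level using (Level)
open import Data.Bool using (Bool; true; false; if_then_else_)
open import Data.Nat using (ℕ; zero; suc; _≤_; _≟_)
import Data.Nat as ℕ
import Data.Nat.Properties as ℕ
open import Data.Fin using (Fin)
import Data.Fin as Fin
open import Data.Vec using ([]; _∷_; updateAt)
open import Data.List using (List; []; _∷_; map; filter; foldr; concatMap; allFin; tabulate)
open import Data.List.Properties using (map-∘; map-cong; map-tabulate; concatMap-map; map-concatMap)
open import Function using (_∘_; id)
open import Relation.Binary.PropositionalEquality as ≡ using (_≡_; cong; cong₂)
open import Relation.Nullary using (¬_; Dec; yes; no; does)
open import Relation.Nullary.Decidable using (does-≡; map′)
open import Algebra.Bundles using (CommutativeSemiring; CommutativeRing)
open import Algebra.Properties.CommutativeSemigroup ℕ.+-commutativeSemigroup using (x∙yz≈y∙xz)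

neighbours-∷ : ∀ {N} (x : Z3) (u : Vertex N) →
  neighbours (x ∷ u) ≡ (inc3 x ∷ u) ∷ (dec3 x ∷ u) ∷ map (x ∷_) (neighbours u)
neighbours-∷ {N} x u = cong (λ ws → (inc3 x ∷ u) ∷ (dec3 x ∷ u) ∷ ws) (begin
  concatMap moves (tabulate Fin.suc)              ≡⟨ cong (concatMap moves) (map-tabulate id Fin.suc) ⟨
  concatMap moves (map Fin.suc (allFin N))        ≡⟨ concatMap-map moves Fin.suc (allFin N) ⟩
  concatMap (map (x ∷_) ∘ movesᵤ) (allFin N)       ≡⟨ map-concatMap (x ∷_) movesᵤ (allFin N) ⟨
  map (x ∷_) (neighbours u)                       ∎)
  where
  open ≡.≡-Reasoning
  moves : Fin (suc N) → List (Vertex (suc N))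
  moves k = updateAt (x ∷ u) k inc3 ∷ updateAt (x ∷ u) k dec3 ∷ []
  movesᵤ : Fin N → List (Vertex N)
  movesᵤ k = updateAt u k inc3 ∷ updateAt u k dec3 ∷ []

LevelRelation : Set
LevelRelation = ℕ → ℕ → Bool

shift : ℕ → ℕ → LevelRelation
shift i j a b = does (i ℕ.+ a ≟ j ℕ.+ b)

-- Definitionally the filters of A₊, A₋ and A₀, applied to d w and d v.
down up flat : LevelRelation
down = shift 1 0
up   = shift 0 1
flat = shift 0 0

TranslationInvariant : LevelRelation → Set
TranslationInvariant ρ = ∀ k a b → ρ (k ℕ.+ a) (k ℕ.+ b) ≡ ρ a b

shift-translationInvariant : ∀ i j → TranslationInvariant (shift i j)
shift-translationInvariant i j k a b =
  does-≡ (i ℕ.+ (k ℕ.+ a) ≟ j ℕ.+ (k ℕ.+ b)) (map′ translate cancel (i ℕ.+ a ≟ j ℕ.+ b))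
  where
  translate : i ℕ.+ a ≡ j ℕ.+ b → i ℕ.+ (k ℕ.+ a) ≡ j ℕ.+ (k ℕ.+ b)
  translate eq = ≡.trans (x∙yz≈y∙xz i k a) (≡.trans (cong (k ℕ.+_) eq) (x∙yz≈y∙xz k j b))
  cancel : i ℕ.+ (k ℕ.+ a) ≡ j ℕ.+ (k ℕ.+ b) → i ℕ.+ a ≡ j ℕ.+ b
  cancel eq = ℕ.+-cancelˡ-≡ k _ _ (≡.trans (x∙yz≈y∙xz k i a) (≡.trans eq (x∙yz≈y∙xz j k b)))

translationInvariantʳ : ∀ {ρ} → TranslationInvariant ρ → ∀ k a b → ρ (a ℕ.+ k) (b ℕ.+ k) ≡ ρ a b
translationInvariantʳ {ρ} inv k a b = ≡.trans (cong₂ ρ (ℕ.+-comm a k) (ℕ.+-comm b k)) (inv k a b)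

module LevelCommutator {c ℓ : Level} (S : CommutativeSemiring c ℓ) where
  open CommutativeSemiring S
  open import Algebra.Properties.Monoid.Mult +-monoid using (_×_; ×-homo-+)
  open import Algebra.Properties.CommutativeSemigroup +-commutativeSemigroup using (interchange)
  open import Algebra.Solver.CommutativeMonoid +-commutativeMonoid using (solve; _⊜_; _⊕_) renaming (id to ∅)
  open import Relation.Binary.Reasoning.Setoid setoid

  sum : List Carrier → Carrier
  sum = foldr _+_ 0#

  mask : Bool → Carrier → Carrier
  mask b x = if b then x else 0#

  mask-cong : ∀ b {x y} → x ≈ y → mask b x ≈ mask b y
  mask-cong true  x≈y = x≈y
  mask-cong false _   = refl

  mask-+ : ∀ b x y → mask b (x + y) ≈ mask b x + mask b y
  mask-+ true  x y = refl
  mask-+ false x y = sym (+-identityʳ 0#)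

  mask-comm : ∀ b b′ x → mask b (mask b′ x) ≡ mask b′ (mask b x)
  mask-comm true  b′    x = ≡.refl
  mask-comm false true  x = ≡.refl
  mask-comm false false x = ≡.refl

  sum-map-cong : ∀ {A : Set} (ws : List A) {g h : A → Carrier} → (∀ w → g w ≈ h w) →
    sum (map g ws) ≈ sum (map h ws)
  sum-map-cong []       g≈h = refl
  sum-map-cong (w ∷ ws) g≈h = +-cong (g≈h w) (sum-map-cong ws g≈h)

  sum-map-+ : ∀ {A : Set} (ws : List A) (g h : A → Carrier) →
    sum (map (λ w → g w + h w) ws) ≈ sum (map g ws) + sum (map h ws)
  sum-map-+ []       g h = sym (+-identityʳ 0#)
  sum-map-+ (w ∷ ws) g h = trans (+-congˡ (sum-map-+ ws g h)) (interchange _ _ _ _)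

  sum-map-mask : ∀ {A : Set} b (ws : List A) (h : A → Carrier) →
    sum (map (λ w → mask b (h w)) ws) ≈ mask b (sum (map h ws))
  sum-map-mask true  ws       h = refl
  sum-map-mask false []       h = refl
  sum-map-mask false (w ∷ ws) h = trans (+-congˡ (sum-map-mask false ws h)) (+-identityʳ 0#)

  sum-filter : ∀ {A : Set} {p} {P : A → Set p} (P? : ∀ w → Dec (P w)) (ws : List A) (h : A → Carrier) →
    sum (map h (filter P? ws)) ≈ sum (map (λ w → mask (does (P? w)) (h w)) ws)
  sum-filter P? []       h = refl
  sum-filter P? (w ∷ ws) h with does (P? w)
  ... | true  = +-congˡ (sum-filter P? ws h)
  ... | false = trans (sum-filter P? ws h) (sym (+-identityˡ _))

  adj : ∀ {N} → LevelRelation → (Vertex N → Carrier) → Vertex N → Carrier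
  adj ρ f v = sum (map (λ w → mask (ρ (d w) (d v)) (f w)) (neighbours v))

  adjC₃ : LevelRelation → (Z3 → Carrier) → Z3 → Carrier
  adjC₃ ρ φ x = mask (ρ (absZ3 (inc3 x)) (absZ3 x)) (φ (inc3 x))
              + mask (ρ (absZ3 (dec3 x)) (absZ3 x)) (φ (dec3 x))

  adj-cong : ∀ {N} ρ {f g : Vertex N → Carrier} → (∀ w → f w ≈ g w) → ∀ v → adj ρ f v ≈ adj ρ g v
  adj-cong ρ f≈g v = sum-map-cong (neighbours v) (λ w → mask-cong (ρ _ _) (f≈g w))

  adj-+ : ∀ {N} ρ (f g : Vertex N → Carrier) v → adj ρ (λ w → f w + g w) v ≈ adj ρ f v + adj ρ g v
  adj-+ ρ f g v = trans (sum-map-cong (neighbours v) (λ w → mask-+ (ρ _ _) (f w) (g w))) (sum-map-+ (neighbours v) _ _)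

  adj-mask : ∀ {N} ρ b (f : Vertex N → Carrier) v → adj ρ (λ w → mask b (f w)) v ≈ mask b (adj ρ f v)
  adj-mask ρ b f v = trans (reflexive (cong sum (map-cong (λ w → mask-comm (ρ _ _) b (f w)) (neighbours v))))
                           (sum-map-mask b (neighbours v) _)

  adjC₃-cong : ∀ ρ {φ ψ} → (∀ y → φ y ≈ ψ y) → ∀ x → adjC₃ ρ φ x ≈ adjC₃ ρ ψ x
  adjC₃-cong ρ φ≈ψ x = +-cong (mask-cong (ρ _ _) (φ≈ψ (inc3 x))) (mask-cong (ρ _ _) (φ≈ψ (dec3 x)))

  adjC₃-+ : ∀ ρ φ ψ x → adjC₃ ρ (λ y → φ y + ψ y) x ≈ adjC₃ ρ φ x + adjC₃ ρ ψ x
  adjC₃-+ ρ φ ψ x = trans (+-cong (mask-+ (ρ _ _) _ _) (mask-+ (ρ _ _) _ _)) (interchange _ _ _ _)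

  adj-adjC₃-comm : ∀ {N} ρ σ (F : Z3 → Vertex N → Carrier) x u →
    adj σ (λ w → adjC₃ ρ (λ y → F y w) x) u ≈ adjC₃ ρ (λ y → adj σ (F y) u) x
  adj-adjC₃-comm ρ σ F x u = trans (adj-+ σ _ _ u) (+-cong (adj-mask σ _ (F (inc3 x)) u) (adj-mask σ _ (F (dec3 x)) u))

  adj-∷ : ∀ {N ρ} → TranslationInvariant ρ → (f : Vertex (suc N) → Carrier) (x : Z3) (u : Vertex N) →
    adj ρ f (x ∷ u) ≈ adjC₃ ρ (λ y → f (y ∷ u)) x + adj ρ (λ w → f (x ∷ w)) u
  adj-∷ {ρ = ρ} inv f x u = begin
    adj ρ f (x ∷ u)
      ≡⟨ cong (sum ∘ map term) (neighbours-∷ x u) ⟩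
    term (inc3 x ∷ u) + (term (dec3 x ∷ u) + rest)
      ≡⟨ cong₂ (λ p q → p + (q + rest)) (coordinate-term (inc3 x)) (coordinate-term (dec3 x)) ⟩
    inc-part + (dec-part + rest)
      ≡⟨ cong (λ s → inc-part + (dec-part + sum s)) (≡.trans (≡.sym (map-∘ (neighbours u))) (map-cong rest-term (neighbours u))) ⟩
    inc-part + (dec-part + adj ρ (λ w → f (x ∷ w)) u)
      ≈⟨ +-assoc _ _ _ ⟨
    adjC₃ ρ (λ y → f (y ∷ u)) x + adj ρ (λ w → f (x ∷ w)) u ∎
    where
    term : Vertex _ → Carrier
    term w = mask (ρ (d w) (d (x ∷ u))) (f w)
    rest : Carrier
    rest = sum (map term (map (x ∷_) (neighbours u)))
    inc-part dec-part : Carrier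
    inc-part = mask (ρ (absZ3 (inc3 x)) (absZ3 x)) (f (inc3 x ∷ u))
    dec-part = mask (ρ (absZ3 (dec3 x)) (absZ3 x)) (f (dec3 x ∷ u))
    coordinate-term : ∀ y → term (y ∷ u) ≡ mask (ρ (absZ3 y) (absZ3 x)) (f (y ∷ u))
    coordinate-term y = cong (λ b → mask b _) (translationInvariantʳ inv (d u) (absZ3 y) (absZ3 x))
    rest-term : ∀ w → term (x ∷ w) ≡ mask (ρ (d w) (d u)) (f (x ∷ w))
    rest-term w = cong (λ b → mask b _) (inv (absZ3 x) (d w) (d u))

  adj-adj-∷ : ∀ {N ρ σ} → TranslationInvariant ρ → TranslationInvariant σ →
    (f : Vertex (suc N) → Carrier) (x : Z3) (u : Vertex N) →
    adj ρ (adj σ f) (x ∷ u) ≈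
      (adjC₃ ρ (adjC₃ σ (λ y → f (y ∷ u))) x + adj ρ (adj σ (λ w → f (x ∷ w))) u)
      + (adjC₃ ρ (λ y → adj σ (λ w → f (y ∷ w)) u) x + adjC₃ σ (λ y → adj ρ (λ w → f (y ∷ w)) u) x)
  adj-adj-∷ {N} {ρ} {σ} ρ-inv σ-inv f x u = begin
    adj ρ (adj σ f) (x ∷ u)
      ≈⟨ adj-∷ ρ-inv (adj σ f) x u ⟩
    adjC₃ ρ (λ y → adj σ f (y ∷ u)) x + adj ρ (λ w → adj σ f (x ∷ w)) u
      ≈⟨ +-cong (adjC₃-cong ρ (λ y → adj-∷ σ-inv f y u) x) (adj-cong ρ (λ w → adj-∷ σ-inv f x w) u) ⟩
    adjC₃ ρ (λ y → adjC₃ σ φ y + adj σ (F y) u) x + adj ρ (λ w → adjC₃ σ (λ y → F y w) x + adj σ g w) u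
      ≈⟨ +-cong (adjC₃-+ ρ (adjC₃ σ φ) (λ y → adj σ (F y) u) x) (trans (adj-+ ρ _ (adj σ g) u) (+-comm _ _)) ⟩
    (adjC₃ ρ (adjC₃ σ φ) x + adjC₃ ρ (λ y → adj σ (F y) u) x)
      + (adj ρ (adj σ g) u + adj ρ (λ w → adjC₃ σ (λ y → F y w) x) u)
      ≈⟨ +-congˡ (+-congˡ (adj-adjC₃-comm σ ρ F x u)) ⟩
    (adjC₃ ρ (adjC₃ σ φ) x + adjC₃ ρ (λ y → adj σ (F y) u) x)
      + (adj ρ (adj σ g) u + adjC₃ σ (λ y → adj ρ (F y) u) x)
      ≈⟨ interchange _ _ _ _ ⟩
    (adjC₃ ρ (adjC₃ σ φ) x + adj ρ (adj σ g) u)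
      + (adjC₃ ρ (λ y → adj σ (F y) u) x + adjC₃ σ (λ y → adj ρ (F y) u) x) ∎
    where
    F : Z3 → Vertex N → Carrier
    F y w = f (y ∷ w)
    φ : Z3 → Carrier
    φ y = f (y ∷ u)
    g : Vertex N → Carrier
    g w = f (x ∷ w)

  adjC₃-identity : ∀ φ x →
    adjC₃ up (adjC₃ down φ) x + adjC₃ flat φ x + (3 ℕ.* absZ3 x) × φ x ≈ adjC₃ down (adjC₃ up φ) x + 2 × φ x
  adjC₃-identity φ zer = solve 1 (λ z → (((∅ ⊕ z) ⊕ (z ⊕ ∅)) ⊕ (∅ ⊕ ∅)) ⊕ ∅ ⊜ (∅ ⊕ ∅) ⊕ (z ⊕ (z ⊕ ∅))) refl (φ zer)
  adjC₃-identity φ neg = solve 2 (λ n p → ((∅ ⊕ ∅) ⊕ (∅ ⊕ p)) ⊕ (n ⊕ (n ⊕ (n ⊕ ∅))) ⊜ ((p ⊕ n) ⊕ ∅) ⊕ (n ⊕ (n ⊕ ∅))) refl (φ neg) (φ pos)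
  adjC₃-identity φ pos = solve 2 (λ n p → ((∅ ⊕ ∅) ⊕ (n ⊕ ∅)) ⊕ (p ⊕ (p ⊕ (p ⊕ ∅))) ⊜ (∅ ⊕ (p ⊕ n)) ⊕ (p ⊕ (p ⊕ ∅))) refl (φ neg) (φ pos)

  up-down-identity : ∀ {N} (f : Vertex N → Carrier) v →
    adj up (adj down f) v + adj flat f v + (3 ℕ.* d v) × f v ≈ adj down (adj up f) v + (2 ℕ.* N) × f v
  up-down-identity f [] = +-identityʳ (0# + 0#)
  up-down-identity {suc N} f (x ∷ u) = begin
    adj up (adj down f) (x ∷ u) + adj flat f (x ∷ u) + (3 ℕ.* (absZ3 x ℕ.+ d u)) × f (x ∷ u)
      ≈⟨ +-cong (+-cong (adj-adj-∷ up-inv down-inv f x u) (adj-∷ flat-inv f x u)) (×-split 3 (absZ3 x) (d u)) ⟩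
    ((P + Q) + (M + M′)) + (adjC₃ flat φ x + adj flat g u) + ((3 ℕ.* absZ3 x) × f (x ∷ u) + (3 ℕ.* d u) × f (x ∷ u))
      ≈⟨ regroupˡ _ _ _ _ _ _ _ _ ⟩
    (P + adjC₃ flat φ x + (3 ℕ.* absZ3 x) × f (x ∷ u)) + (Q + adj flat g u + (3 ℕ.* d u) × f (x ∷ u)) + (M + M′)
      ≈⟨ +-congʳ (+-cong (adjC₃-identity φ x) (up-down-identity g u)) ⟩
    (P′ + 2 × f (x ∷ u)) + (Q′ + (2 ℕ.* N) × f (x ∷ u)) + (M + M′)
      ≈⟨ regroupʳ _ _ _ _ _ _ ⟩
    ((P′ + Q′) + (M′ + M)) + (2 × f (x ∷ u) + (2 ℕ.* N) × f (x ∷ u))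
      ≈⟨ +-cong (adj-adj-∷ down-inv up-inv f x u) (×-split 2 1 N) ⟨
    adj down (adj up f) (x ∷ u) + (2 ℕ.* suc N) × f (x ∷ u) ∎
    where
    up-inv : TranslationInvariant up
    up-inv = shift-translationInvariant 0 1
    down-inv : TranslationInvariant down
    down-inv = shift-translationInvariant 1 0
    flat-inv : TranslationInvariant flat
    flat-inv = shift-translationInvariant 0 0
    φ : Z3 → Carrier
    φ y = f (y ∷ u)
    g : Vertex N → Carrier
    g w = f (x ∷ w)
    P P′ Q Q′ M M′ : Carrier
    P = adjC₃ up (adjC₃ down φ) x
    P′ = adjC₃ down (adjC₃ up φ) x
    Q = adj up (adj down g) u
    Q′ = adj down (adj up g) u
    M = adjC₃ up (λ y → adj down (λ w → f (y ∷ w)) u) x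
    M′ = adjC₃ down (λ y → adj up (λ w → f (y ∷ w)) u) x
    ×-split : ∀ k m n → (k ℕ.* (m ℕ.+ n)) × f (x ∷ u) ≈ (k ℕ.* m) × f (x ∷ u) + (k ℕ.* n) × f (x ∷ u)
    ×-split k m n = trans (reflexive (cong (_× f (x ∷ u)) (ℕ.*-distribˡ-+ k m n))) (×-homo-+ _ (k ℕ.* m) (k ℕ.* n))
    regroupˡ : ∀ p q m m′ s s′ t t′ → ((p + q) + (m + m′)) + (s + s′) + (t + t′) ≈ (p + s + t) + (q + s′ + t′) + (m + m′)
    regroupˡ = solve 8 (λ p q m m′ s s′ t t′ →
      (((p ⊕ q) ⊕ (m ⊕ m′)) ⊕ (s ⊕ s′)) ⊕ (t ⊕ t′) ⊜ (((p ⊕ s) ⊕ t) ⊕ ((q ⊕ s′) ⊕ t′)) ⊕ (m ⊕ m′)) refl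
    regroupʳ : ∀ p q t t′ m m′ → (p + t) + (q + t′) + (m + m′) ≈ ((p + q) + (m′ + m)) + (t + t′)
    regroupʳ = solve 6 (λ p q t t′ m m′ →
      ((p ⊕ t) ⊕ (q ⊕ t′)) ⊕ (m ⊕ m′) ⊜ ((p ⊕ q) ⊕ (m′ ⊕ m)) ⊕ (t ⊕ t′)) refl

module LevelCommutatorRing {c ℓ : Level} (R : CommutativeRing c ℓ) where
  open CommutativeRing R
  open Ops R
  open LevelCommutator commutativeSemiring
  open import Algebra.Properties.Monoid.Mult +-monoid using (_×_)
  open import Algebra.Properties.Group +-group using (//-rightDividesʳ)
  open import Algebra.Properties.Ring ring using (-‿distribˡ-*)
  open import Algebra.Properties.AbelianGroup +-abelianGroup using (xyx⁻¹≈y)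
  open import Algebra.Properties.CommutativeSemigroup +-commutativeSemigroup using (xy∙z≈xz∙y)
  open import Relation.Binary.Reasoning.Setoid setoid

  ι*≈× : ∀ n x → ι n * x ≈ n × x
  ι*≈× zero    x = zeroˡ x
  ι*≈× (suc n) x = trans (distribʳ x 1# (ι n)) (+-cong (*-identityˡ x) (ι*≈× n x))

  x+y≈z⇒x≈z-y : ∀ {x y z} → x + y ≈ z → x ≈ z - y
  x+y≈z⇒x≈z-y {x} {y} x+y≈z = trans (sym (//-rightDividesʳ y x)) (+-congʳ x+y≈z)

  x+y≈z+w⇒x-z≈w-y : ∀ {x y z w} → x + y ≈ z + w → x - z ≈ w - y
  x+y≈z+w⇒x-z≈w-y {x} {y} {z} {w} x+y≈z+w = begin
    x - z           ≈⟨ +-congʳ (x+y≈z⇒x≈z-y x+y≈z+w) ⟩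
    z + w - y - z   ≈⟨ +-congʳ (+-assoc z w (- y)) ⟩
    z + (w - y) - z ≈⟨ xyx⁻¹≈y z (w - y) ⟩
    w - y           ∎

  A₊≈adj : ∀ {N} (f : VFun N) v → A₊ f v ≈ adj down f v
  A₊≈adj f v = sum-filter (λ w → suc (d w) ≟ d v) (neighbours v) f

  A₋≈adj : ∀ {N} (f : VFun N) v → A₋ f v ≈ adj up f v
  A₋≈adj f v = sum-filter (λ w → d w ≟ suc (d v)) (neighbours v) f

  A₀≈adj : ∀ {N} (f : VFun N) v → A₀ f v ≈ adj flat f v
  A₀≈adj f v = sum-filter (λ w → d w ≟ d v) (neighbours v) f

  C+A₀≈ : ∀ {N} (f : VFun N) v → C f v + A₀ f v ≈ (ι (2 ℕ.* N) - ι (3 ℕ.* d v)) * f v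
  C+A₀≈ {N} f v = begin
    A₋ (A₊ f) v - A₊ (A₋ f) v + A₀ f v      ≈⟨ xy∙z≈xz∙y _ _ _ ⟩
    A₋ (A₊ f) v + A₀ f v - A₊ (A₋ f) v      ≈⟨ x+y≈z+w⇒x-z≈w-y identity ⟩
    ι (2 ℕ.* N) * f v - ι (3 ℕ.* d v) * f v ≈⟨ +-congˡ (-‿distribˡ-* _ _) ⟩
    ι (2 ℕ.* N) * f v + - ι (3 ℕ.* d v) * f v ≈⟨ distribʳ _ _ _ ⟨
    (ι (2 ℕ.* N) - ι (3 ℕ.* d v)) * f v     ∎
    where
    up∘down : A₋ (A₊ f) v ≈ adj up (adj down f) v
    up∘down = trans (A₋≈adj (A₊ f) v) (adj-cong up (A₊≈adj f) v)
    down∘up : A₊ (A₋ f) v ≈ adj down (adj up f) v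
    down∘up = trans (A₊≈adj (A₋ f) v) (adj-cong down (A₋≈adj f) v)
    identity : A₋ (A₊ f) v + A₀ f v + ι (3 ℕ.* d v) * f v ≈ A₊ (A₋ f) v + ι (2 ℕ.* N) * f v
    identity = begin
      A₋ (A₊ f) v + A₀ f v + ι (3 ℕ.* d v) * f v
        ≈⟨ +-cong (+-cong up∘down (A₀≈adj f v)) (ι*≈× (3 ℕ.* d v) (f v)) ⟩
      adj up (adj down f) v + adj flat f v + (3 ℕ.* d v) × f v
        ≈⟨ up-down-identity f v ⟩
      adj down (adj up f) v + (2 ℕ.* N) × f v
        ≈⟨ +-cong down∘up (ι*≈× (2 ℕ.* N) (f v)) ⟨
      A₊ (A₋ f) v + ι (2 ℕ.* N) * f v ∎

  *-level-supported : ∀ {N} (s : ℕ → Carrier) r (f : VFun N) → (∀ v → ¬ (d v ≡ r) → f v ≈ 0#) →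
    ∀ v → s (d v) * f v ≈ s r * f v
  *-level-supported s r f supported v with d v ≟ r
  ... | yes dv≡r = *-congʳ (reflexive (cong s dv≡r))
  ... | no  dv≢r = begin
    s (d v) * f v ≈⟨ *-congˡ (supported v dv≢r) ⟩
    s (d v) * 0#  ≈⟨ zeroʳ _ ⟩
    0#            ≈⟨ zeroʳ _ ⟨
    s r * 0#      ≈⟨ *-congˡ (supported v dv≢r) ⟨
    s r * f v     ∎

open import Data.Product using (_×_; _,_)

mainTheorem2 : {c ℓ : Level} (R : CommutativeRing c ℓ) →
    let open CommutativeRing R
        open Ops R
    in (N : ℕ) → 1 ≤ N → (r : ℕ) → r ≤ N →
       (f : Vertex N → Carrier) → (∀ v → ¬ (d v ≡ r) → f v ≈ 0#) →
       (∀ v → C f v ≈ (ι (2 ℕ.* N) - ι (3 ℕ.* r)) * f v - A₀ f v)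
       × (∀ v → C f v + A₀ f v ≈ (ι (2 ℕ.* N) - ι (3 ℕ.* r)) * f v)
mainTheorem2 R N _ r _ f supported = (λ v → x+y≈z⇒x≈z-y (eigen v)) , eigen
  where
  open CommutativeRing R
  open Ops R
  open LevelCommutatorRing R
  eigen : ∀ v → C f v + A₀ f v ≈ (ι (2 ℕ.* N) - ι (3 ℕ.* r)) * f v
  eigen v = trans (C+A₀≈ f v) (*-level-supported (λ k → ι (2 ℕ.* N) - ι (3 ℕ.* k)) r f supported v)
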